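{- The map $\Gamma:\mathcal P_\infty\to\mathcal T_\infty$ satisfies, for all $n$ and $\gamma,\delta\in\mathcal P_n$: (1) if $\gamma\subseteq\delta$ in $\mathcal P_n$ then $\Gamma(\gamma)\subseteq\Gamma(\delta)$ in $\mathcal T_n$; (2) if $\gamma\le_B\delta$ in $\mathcal P_n$ then $\Gamma(\gamma)\le_B\Gamma(\delta)$ in $\mathcal T_n$.
   Context: $\mathcal P_n$ ($n\ge1$): surjective maps $\gamma:\{1,\dots,n\}\to\{1,\dots,r\}$, $r\ge1$; $\mathcal P_{n,r}$ those with image $\{1,\dots,r\}$; $\mathcal P_0=\{(0)\}$, $\mathcal P_\infty=\bigsqcup\mathcal P_n$. On $\mathcal P_n$: $\gamma\subseteq\delta$ iff $\delta=\rho\circ\gamma$ for a non-decreasing surjection $\rho$; weak Bruhat order $\le_B$ is the reflexive transitive closure of $\gamma<_B t_i\circ\gamma$ when every element of $\gamma^{ -1}(i)$ is less than every element of $\gamma^{ -1}(i+1)$, and $t_i\circ\gamma<_B\gamma$ when every element of $\gamma^{ -1}(i)$ exceeds every element of $\gamma^{ -1}(i+1)$, where for $\gamma\in\mathcal P_{n,r}$, $1\le i\le r-1$, $t_i:\{1,\dots,r\}\to\{1,\dots,r-1\}$, $t_i(j)=j$ ($j\le i$), $j-1$ ($j>i$). Trees: planar rooted trees, every vertex having $\ge2$ ordered incoming edges and one outgoing edge; $\mathcal T_n$ = trees with $n+1$ leaves, $\mathcal T_0=\{\downarrow\}$ (one leaf, no vertex); $\bigvee(t^0,\dots,t^k)$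 ($k\ge1$) joins the roots of $t^0,\dots,t^k$ in order to a new vertex with a new root. On $\mathcal T_n$: $\subseteq$ is the reflexive transitive closure of $t\subseteq t_e$, $t_e$ obtained by contracting an internal edge $e$ of $t$; $\le_B$ is the smallest family of reflexive transitive relations with (1) $t^{i_0}<_B w^{i_0}$ in $\mathcal T_{n_{i_0}}$ implies $\bigvee(t^0,\dots,t^{i_0},\dots,t^k)<_B\bigvee(t^0,\dots,w^{i_0},\dots,t^k)$; (2) $\bigvee(t,w^0,\dots,w^h)<_B\bigvee(t^0,\dots,t^k,w^0,\dots,w^h)$ if $t=\bigvee(t^0,\dots,t^k)$; (3) $t<_B\bigvee(t^0,\dots,t^j,\bigvee(t^{j+1},\dots,t^k))$ if $t=\bigvee(t^0,\dots,t^k)$, $0\le j\le k-2$. The map $\Gamma$: $\Gamma((0))=\downarrow$; for $\gamma\in\mathcal P_{n,r}$, $n\ge1$, let $\gamma^{ -1}(r)=\{j_1<\dots<j_k\}$, $j_0=0$, $j_{k+1}=n+1$; for $0\le i\le k$ let $\gamma_i$ be the restriction of $\gamma$ to $\{j_i+1,\dots,j_{i+1}-1\}$ (reindexed as $1,2,\dots$) followed by the order-preserving bijection of its image onto $\{1,\dots,r_i\}$, with $\gamma_i=(0)$ if that interval is empty; then $\Gamma(\gamma)=\bigvee(\Gamma(\gamma_0),\dots,\Gamma(\gamma_k))$. -}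

module Defs where

open import Data.Nat as ℕ using (ℕ; zero; suc; _∸_; _⊔_; _≡ᵇ_)
open import Data.Nat.Properties using (_≟_)
open import Data.Fin as Fin using (Fin; inject₁)
open import Data.Bool using (if_then_else_)
open import Data.List as List using (List; []; _∷_; [_]; _++_; length; filter; upTo; foldr)
open import Data.List.Membership.DecPropositional _≟_ using (_∈?_)
open import Data.Vec as Vec using (Vec; lookup)
open import Data.Vec.Membership.Propositional renaming (_∈_ to _∈ᵥ_)
open import Data.Product using (Σ; ∃; _×_; _,_)
open import Relation.Binary.PropositionalEquality using (_≡_)
open import Relation.Binary.Construct.Closure.ReflexiveTransitive using (Star)

-- Surjections  P_n
-- An element of P_{n,r} is a vector of length n with entries in Fin r
-- (0-indexed: value k stands for k+1 in the paper), required surjective.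
-- P_0 = {(0)} is the empty vector with r = 0 (the only surjection from Fin 0).

PRaw : ℕ → Set
PRaw n = Σ ℕ (λ r → Vec (Fin r) n)

IsSurj : ∀ {n} → PRaw n → Set
IsSurj (r , γ) = ∀ (j : Fin r) → j ∈ᵥ γ

_⊆P_ : ∀ {n} → PRaw n → PRaw n → Set
(r , γ) ⊆P (s , δ) =
  Σ (Fin r → Fin s) λ ρ →
    (∀ {a b} → a Fin.≤ b → ρ a Fin.≤ ρ b)
    × (∀ (j : Fin s) → ∃ λ a → ρ a ≡ j)
    × (δ ≡ Vec.map ρ γ)

-- t_i : {1..r} → {1..r-1}, 0-indexed: r = 2+m, i ∈ Fin (1+m) stands for i+1;
-- t i j = j if j ≤ i, j-1 if j > i  (merges inject₁ i and suc i)
t : ∀ {m} → Fin (suc m) → Fin (suc (suc m)) → Fin (suc m)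
t _ Fin.zero = Fin.zero
t Fin.zero (Fin.suc j) = j
t {suc m} (Fin.suc i) (Fin.suc j) = Fin.suc (t i j)

data StepB (n : ℕ) : PRaw n → PRaw n → Set where
  up : ∀ {m} (γ : Vec (Fin (suc (suc m))) n) (i : Fin (suc m)) →
       IsSurj (suc (suc m) , γ) →
       (∀ x y → lookup γ x ≡ inject₁ i → lookup γ y ≡ Fin.suc i → x Fin.< y) →
       StepB n (suc (suc m) , γ) (suc m , Vec.map (t i) γ)
  down : ∀ {m} (γ : Vec (Fin (suc (suc m))) n) (i : Fin (suc m)) →
       IsSurj (suc (suc m) , γ) →
       (∀ x y → lookup γ x ≡ inject₁ i → lookup γ y ≡ Fin.suc i → y Fin.< x) →
       StepB n (suc m , Vec.map (t i) γ) (suc (suc m) , γ)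

_≤BP_ : ∀ {n} → PRaw n → PRaw n → Set
_≤BP_ {n} = Star (StepB n)

-- Planar rooted trees, every vertex with ≥ 2 ordered children.
-- leaf = ↓ ;  node ts = ⋁(ts).

data Tree : Set where
  leaf : Tree
  node : (ts : List Tree) → .(2 ℕ.≤ length ts) → Tree

data Contract : Tree → Tree → Set where
  here : ∀ pre ts post .p .q .r →
         Contract (node (pre ++ node ts p ∷ post) q) (node (pre ++ ts ++ post) r)
  there : ∀ pre {a b} post .q .r → Contract a b →
         Contract (node (pre ++ a ∷ post) q) (node (pre ++ b ∷ post) r)

_⊆T_ : Tree → Tree → Set
_⊆T_ = Star Contract

-- weak Bruhat order on trees (one relation on all trees; all rules preserve
-- the number of leaves, so it restricts to the family on the T_n)
data _≤BT_ : Tree → Tree → Set where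
  refl : ∀ {a} → a ≤BT a
  trans : ∀ {a b c} → a ≤BT b → b ≤BT c → a ≤BT c
  cong : ∀ pre {a b} post .q .r → a ≤BT b →
         node (pre ++ a ∷ post) q ≤BT node (pre ++ b ∷ post) r
  merge : ∀ ts w ws .p .q .r →
         node (node ts p ∷ w ∷ ws) q ≤BT node (ts ++ w ∷ ws) r
  split : ∀ x xs suf .p .q .r →
         node ((x ∷ xs) ++ suf) p ≤BT node ((x ∷ xs) ++ [ node suf q ]) r

rank : List ℕ → ℕ → ℕ
rank xs x = length (filter (_∈? xs) (upTo x))

std : List ℕ → List ℕ
std xs = List.map (rank xs) xs

imgSize : List ℕ → ℕ
imgSize xs = rank xs (suc (foldr _⊔_ 0 xs))

-- split at every occurrence of v, keeping empty blocks
splitAt : ℕ → List ℕ → List (List ℕ)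
splitAt v [] = [ [] ]
splitAt v (x ∷ xs) with splitAt v xs
... | [] = [ [] ]   -- unreachable
... | b ∷ bs = if x ≡ᵇ v then [] ∷ b ∷ bs else (x ∷ b) ∷ bs

-- ⋁ of a list of trees (degenerate cases never occur for surjections)
mkNode : List Tree → Tree
mkNode [] = leaf
mkNode (a ∷ []) = a
mkNode (a ∷ b ∷ cs) = node (a ∷ b ∷ cs) (ℕ.s≤s (ℕ.s≤s ℕ.z≤n))

-- fuel-bounded Γ on (r, list of values in {0..r-1}); fuel = length suffices
Γraw : ℕ → ℕ → List ℕ → Tree
Γraw _ _ [] = leaf
Γraw zero _ (_ ∷ _) = leaf
Γraw (suc f) r (x ∷ xs) =
  mkNode (List.map (λ b → Γraw f (imgSize b) (std b)) (splitAt (r ∸ 1) (x ∷ xs)))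

Γ : ∀ {n} → PRaw n → Tree
Γ {n} (r , γ) = Γraw n r (Vec.toList (Vec.map Fin.toℕ γ))

-- Γ cuts a word at the occurrences of its largest letter and recurses on the blocks, so it only
-- depends on the relative order of the letters. A monotone relabelling ρ sends the largest letter
-- M to the largest letter ρ M, and cutting ρ ∘ γ at ρ M amounts to cutting γ at M and then every
-- block at ρ M; the second round of cuts replaces children of the root by their own children,
-- i.e. contracts edges. A Bruhat step t_i is an order embedding unless both i and i+1 occur. If
-- i+1 is not the largest letter, the step happens inside the blocks (rule (1)); if it is, all the
-- i's lie in the block before the first i+1 (resp. after the last one), and t_i moves the cuts of
-- that block at i up to the root, which is rule (2) (resp. rule (3)).

module Submission where

open import Defs
  renaming (here to contract-here; there to contract-there; refl to ≤BT-refl; trans to ≤BT-trans; cong to ≤BT-cong)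
open import Data.Nat as ℕ using (ℕ; zero; suc; _+_; _∸_; _⊔_; _≡ᵇ_; _≤_; _<_; z≤n; s≤s)
open import Data.Nat.Properties
open import Data.Bool using (true; false; T)
open import Data.Unit using (⊤; tt)
open import Data.Sum using (_⊎_; inj₁; inj₂; [_,_]′)
open import Data.List using (List; []; _∷_; [_]; _++_; length; foldr; map; concat; concatMap; filter; upTo)
open import Data.List.Properties
  using (++-assoc; length-++; length-++-≤ˡ; length-++-≤ʳ; length-map; map-++; map-∘; map-cong; map-cong-local;
         map-id-local; concat-map; concat-map-[_]; filter-accept; filter-++; upTo-∷ʳ)
open import Data.List.Membership.DecPropositional _≟_ using (_∈?_)
open import Data.List.Relation.Unary.Any using (here; there)
open import Data.List.Relation.Unary.All using (All; []; _∷_)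
import Data.List.Relation.Unary.All as All
import Data.List.Relation.Unary.All.Properties as Allₚ
open import Data.List.Membership.Propositional using (_∈_; _∉_)
open import Data.List.Membership.Propositional.Properties using (∈-map⁺; ∈-map⁻; ∈-∃++; ∈-++⁺ʳ; ∈-++⁻)
open import Data.List.Relation.Binary.Sublist.Propositional using (_⊆_; []; _∷_; _∷ʳ_; minimum)
open import Data.List.Relation.Binary.Sublist.Propositional.Properties using (length-mono-≤; Any-resp-⊆; All-resp-⊆)
open import Data.Product using (∃; ∃₂; _×_; _,_; proj₁)
open import Data.Fin as Fin using (Fin; toℕ; fromℕ; inject₁)
open import Data.Fin.Properties using (toℕ-injective; toℕ-fromℕ; toℕ-inject₁; toℕ≤pred[n])
open import Data.Vec as Vec using (Vec; lookup)
open import Data.Vec.Properties using (length-toList)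
open import Data.Vec.Membership.Propositional.Properties using (∈-toList⁺) renaming (∈-map⁺ to ∈ᵥ-map⁺)
open import Function using (_∘_; flip; id)
open import Relation.Binary.Core using (_Preserves_⟶_)
open import Relation.Nullary using (yes; no; contradiction)
open import Relation.Binary.Definitions using (tri<; tri≈; tri>)
open import Relation.Binary.PropositionalEquality
  using (_≡_; _≢_; refl; sym; trans; cong; cong₂; subst; subst₂; module ≡-Reasoning)
open import Relation.Binary.Construct.Closure.ReflexiveTransitive using (ε; _◅_; _◅◅_)
open import Relation.Binary.Construct.Closure.ReflexiveTransitive.Properties using (module StarReasoning)


∉-∷ : ∀ {v x : ℕ} {xs} → x ≢ v → v ∉ xs → v ∉ x ∷ xs
∉-∷ x≢v v∉xs (here v≡x) = x≢v (sym v≡x)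
∉-∷ x≢v v∉xs (there v∈) = v∉xs v∈

∈-++-∷⁻ : ∀ {a b : ℕ} P {Q} → a ∈ P ++ b ∷ Q → a ≢ b → a ∈ P ⊎ a ∈ Q
∈-++-∷⁻ P a∈ a≢b with ∈-++⁻ P a∈
... | inj₁ a∈P         = inj₁ a∈P
... | inj₂ (here a≡b)  = contradiction a≡b a≢b
... | inj₂ (there a∈Q) = inj₂ a∈Q

length-++-∷-<ˡ : ∀ {A : Set} (P : List A) {b Q} → length P < length (P ++ b ∷ Q)
length-++-∷-<ˡ P = subst (length P <_) (sym (length-++ P)) (m<m+n (length P) (s≤s z≤n))

length-++-∷-<ʳ : ∀ {A : Set} (P : List A) {b Q} → length Q < length (P ++ b ∷ Q)
length-++-∷-<ʳ P {b} {Q} = length-++-≤ʳ (b ∷ Q) {P}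

⊆-length< : ∀ {A : Set} {x : A} {xs ys} → xs ⊆ ys → x ∈ ys → x ∉ xs → length xs < length ys
⊆-length< (_ ∷ʳ τ)   _           _    = s≤s (length-mono-≤ τ)
⊆-length< (refl ∷ τ) (here refl) x∉xs = contradiction (here refl) x∉xs
⊆-length< (refl ∷ τ) (there x∈) x∉xs = s≤s (⊆-length< τ x∈ (x∉xs ∘ there))

length≤length-concat : ∀ {A : Set} {tss : List (List A)} → All (_≢ []) tss → length tss ≤ length (concat tss)
length≤length-concat [] = z≤n
length≤length-concat {tss = [] ∷ _}      (ts≢[] ∷ _)  = contradiction refl ts≢[]
length≤length-concat {tss = (t ∷ ts) ∷ _} (_ ∷ tss≢[]) =
  s≤s (≤-trans (length≤length-concat tss≢[]) (length-++-≤ʳ _ {ts}))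

first-occurrence : ∀ {v xs} → v ∈ xs → ∃₂ λ P Q → xs ≡ P ++ v ∷ Q × v ∉ P
first-occurrence {v} {x ∷ xs} v∈ with x ≟ v
... | yes refl = [] , xs , refl , λ ()
first-occurrence {v} {x ∷ xs} (here refl) | no x≢v = contradiction refl x≢v
first-occurrence {v} {x ∷ xs} (there v∈)  | no x≢v with first-occurrence v∈
... | P , Q , refl , v∉P = x ∷ P , Q , refl , ∉-∷ x≢v v∉P

last-occurrence : ∀ {v xs} → v ∈ xs → ∃₂ λ P Q → xs ≡ P ++ v ∷ Q × v ∉ Q
last-occurrence {v} {x ∷ xs} v∈ with v ∈? xs
... | yes v∈xs with last-occurrence v∈xs
...   | P , Q , refl , v∉Q = x ∷ P , Q , refl , v∉Q
last-occurrence {v} {x ∷ xs} (here refl) | no v∉xs = [] , xs , refl , v∉xs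
last-occurrence {v} {x ∷ xs} (there v∈)  | no v∉xs = contradiction v∈ v∉xs

InjectiveOn : (ℕ → ℕ) → List ℕ → Set
InjectiveOn g xs = ∀ {x y} → x ∈ xs → y ∈ xs → g x ≡ g y → x ≡ y


max : List ℕ → ℕ
max = foldr _⊔_ 0

∈⇒≤max : ∀ {x xs} → x ∈ xs → x ≤ max xs
∈⇒≤max {xs = y ∷ ys} (here refl) = m≤m⊔n y (max ys)
∈⇒≤max {xs = y ∷ ys} (there p)   = ≤-trans (∈⇒≤max p) (m≤n⊔m y (max ys))

xs≤max : ∀ xs → All (_≤ max xs) xs
xs≤max xs = All.tabulate ∈⇒≤max

max-lub : ∀ {k xs} → All (_≤ k) xs → max xs ≤ k
max-lub []         = z≤n
max-lub (x≤k ∷ xs) = ⊔-lub x≤k (max-lub xs)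

max∈ : ∀ x xs → max (x ∷ xs) ∈ x ∷ xs
max∈ x []       = here (⊔-identityʳ x)
max∈ x (y ∷ ys) with ⊔-sel x (max (y ∷ ys))
... | inj₁ eq = here eq
... | inj₂ eq = there (subst (_∈ y ∷ ys) (sym eq) (max∈ y ys))

max≡ : ∀ {v xs} → v ∈ xs → All (_≤ v) xs → max xs ≡ v
max≡ v∈xs xs≤v = ≤-antisym (max-lub xs≤v) (∈⇒≤max v∈xs)

max-map : ∀ {f} → f Preserves _≤_ ⟶ _≤_ → ∀ x xs → max (map f (x ∷ xs)) ≡ f (max (x ∷ xs))
max-map {f} mono x xs = max≡ (∈-map⁺ f (max∈ x xs)) (All.tabulate bound)
  where
  bound : ∀ {y} → y ∈ map f (x ∷ xs) → y ≤ f (max (x ∷ xs))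
  bound y∈ with ∈-map⁻ f y∈
  ... | _ , z∈ , refl = mono (∈⇒≤max z∈)

All≤-pred : ∀ {v xs} → All (_≤ suc v) xs → suc v ∉ xs → All (_≤ v) xs
All≤-pred []            _      = []
All≤-pred (y≤ ∷ xs≤) sv∉ = ≤-pred (≤∧≢⇒< y≤ (sv∉ ∘ here ∘ sym)) ∷ All≤-pred xs≤ (sv∉ ∘ there)


-- Splitting a word at a value

consFirst : ℕ → List (List ℕ) → List (List ℕ)
consFirst x []       = [ [ x ] ]
consFirst x (b ∷ bs) = (x ∷ b) ∷ bs

splitAt-nonempty : ∀ v xs → ∃₂ λ b bs → splitAt v xs ≡ b ∷ bs
splitAt-nonempty v []       = _ , _ , refl
splitAt-nonempty v (x ∷ xs) with splitAt v xs | splitAt-nonempty v xs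
... | b ∷ bs | _ with x ≡ᵇ v
...   | true  = _ , _ , refl
...   | false = _ , _ , refl

splitAt-∷-≡ : ∀ {v x} xs → x ≡ v → splitAt v (x ∷ xs) ≡ [] ∷ splitAt v xs
splitAt-∷-≡ {v} {x} xs x≡v with splitAt v xs | splitAt-nonempty v xs
... | b ∷ bs | _ with x ≡ᵇ v | ≡⇒≡ᵇ x v x≡v
...   | true | _ = refl

splitAt-∷-≢ : ∀ {v x} xs → x ≢ v → splitAt v (x ∷ xs) ≡ consFirst x (splitAt v xs)
splitAt-∷-≢ {v} {x} xs x≢v with splitAt v xs | splitAt-nonempty v xs
... | b ∷ bs | _ with x ≡ᵇ v in eq
...   | false = refl
...   | true  = contradiction (≡ᵇ⇒≡ x v (subst T (sym eq) tt)) x≢v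

splitAt-∷-++ : ∀ v y ys zs R → splitAt v ys ≡ splitAt v zs ++ R →
               splitAt v (y ∷ ys) ≡ splitAt v (y ∷ zs) ++ R
splitAt-∷-++ v y ys zs R eq with y ≟ v
... | yes y≡v = begin
  splitAt v (y ∷ ys)          ≡⟨ splitAt-∷-≡ ys y≡v ⟩
  [] ∷ splitAt v ys           ≡⟨ cong ([] ∷_) eq ⟩
  [] ∷ splitAt v zs ++ R      ≡⟨ cong (_++ R) (splitAt-∷-≡ zs y≡v) ⟨
  splitAt v (y ∷ zs) ++ R     ∎
  where open ≡-Reasoning
... | no y≢v = begin
  splitAt v (y ∷ ys)                  ≡⟨ splitAt-∷-≢ ys y≢v ⟩
  consFirst y (splitAt v ys)          ≡⟨ cong (consFirst y) eq ⟩
  consFirst y (splitAt v zs ++ R)     ≡⟨ consFirst-++ (splitAt-nonempty v zs) ⟩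
  consFirst y (splitAt v zs) ++ R     ≡⟨ cong (_++ R) (splitAt-∷-≢ zs y≢v) ⟨
  splitAt v (y ∷ zs) ++ R             ∎
  where
  open ≡-Reasoning
  consFirst-++ : ∀ {bs} → (∃₂ λ b bs′ → bs ≡ b ∷ bs′) → consFirst y (bs ++ R) ≡ consFirst y bs ++ R
  consFirst-++ (_ , _ , refl) = refl

splitAt-++-∷ : ∀ v P Q → splitAt v (P ++ v ∷ Q) ≡ splitAt v P ++ splitAt v Q
splitAt-++-∷ v []      Q = splitAt-∷-≡ Q refl
splitAt-++-∷ v (p ∷ P) Q = splitAt-∷-++ v p (P ++ v ∷ Q) P (splitAt v Q) (splitAt-++-∷ v P Q)

splitAt-∉ : ∀ {v} xs → v ∉ xs → splitAt v xs ≡ [ xs ]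
splitAt-∉ []       v∉xs = refl
splitAt-∉ {v} (x ∷ xs) v∉xs = begin
  splitAt v (x ∷ xs)              ≡⟨ splitAt-∷-≢ xs (λ x≡v → v∉xs (here (sym x≡v))) ⟩
  consFirst x (splitAt v xs)      ≡⟨ cong (consFirst x) (splitAt-∉ xs (v∉xs ∘ there)) ⟩
  [ x ∷ xs ]                      ∎
  where open ≡-Reasoning

∈-splitAt⁻ : ∀ {v B} xs → B ∈ splitAt v xs → B ⊆ xs × v ∉ B
∈-splitAt⁻ [] (here refl) = [] , λ ()
∈-splitAt⁻ {v} {B} (x ∷ xs) B∈ with x ≟ v
... | yes x≡v with subst (B ∈_) (splitAt-∷-≡ xs x≡v) B∈
...   | here refl = minimum (x ∷ xs) , λ ()
...   | there B∈′ = let B⊆xs , v∉B = ∈-splitAt⁻ xs B∈′ in x ∷ʳ B⊆xs , v∉B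
∈-splitAt⁻ {v} {B} (x ∷ xs) B∈ | no x≢v
  with splitAt v xs | (λ {C} → ∈-splitAt⁻ {v} {C} xs) | subst (B ∈_) (splitAt-∷-≢ xs x≢v) B∈
... | []     | _  | here refl  = refl ∷ minimum xs , ∉-∷ x≢v λ ()
... | b ∷ bs | ih | here refl  = let b⊆xs , v∉b = ih (here refl) in refl ∷ b⊆xs , ∉-∷ x≢v v∉b
... | b ∷ bs | ih | there B∈′ = let B⊆xs , v∉B = ih (there B∈′) in x ∷ʳ B⊆xs , v∉B

∈-splitAt⇒length< : ∀ {v B xs} → v ∈ xs → B ∈ splitAt v xs → length B < length xs
∈-splitAt⇒length< {xs = xs} v∈xs B∈ = let B⊆xs , v∉B = ∈-splitAt⁻ xs B∈ in ⊆-length< B⊆xs v∈xs v∉B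

∈-splitAt⇒length≤ : ∀ {f v B xs} → v ∈ xs → B ∈ splitAt v xs → length xs ≤ suc f → length B ≤ f
∈-splitAt⇒length≤ v∈xs B∈ xs≤ = ≤-pred (≤-trans (∈-splitAt⇒length< v∈xs B∈) xs≤)

splitAt-length : ∀ {v xs} → v ∈ xs → 2 ≤ length (splitAt v xs)
splitAt-length {v} v∈xs with ∈-∃++ v∈xs
... | P , Q , refl = begin
  2                                          ≤⟨ +-mono-≤ (nonempty P) (nonempty Q) ⟩
  length (splitAt v P) + length (splitAt v Q) ≡⟨ length-++ (splitAt v P) ⟨
  length (splitAt v P ++ splitAt v Q)        ≡⟨ cong length (splitAt-++-∷ v P Q) ⟨
  length (splitAt v (P ++ v ∷ Q))            ∎
  where
  open ≤-Reasoning
  nonempty : ∀ ys → 1 ≤ length (splitAt v ys)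
  nonempty ys with splitAt-nonempty v ys
  ... | _ , _ , eq = subst (λ bs → 1 ≤ length bs) (sym eq) (s≤s z≤n)

splitAt-map : ∀ f M xs → splitAt (f M) (map f xs) ≡ concatMap (splitAt (f M) ∘ map f) (splitAt M xs)
splitAt-map f M []       = refl
splitAt-map f M (x ∷ xs) with x ≟ M | splitAt-nonempty M xs
... | yes refl | _ = begin
  splitAt (f M) (f M ∷ map f xs)                    ≡⟨ splitAt-∷-≡ (map f xs) refl ⟩
  [] ∷ splitAt (f M) (map f xs)                     ≡⟨ cong ([] ∷_) (splitAt-map f M xs) ⟩
  concatMap F ([] ∷ splitAt M xs)                   ≡⟨ cong (concatMap F) (splitAt-∷-≡ xs refl) ⟨
  concatMap F (splitAt M (M ∷ xs))                  ∎
  where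
  open ≡-Reasoning
  F = splitAt (f M) ∘ map f
... | no x≢M | b , bs , eq = begin
  splitAt (f M) (f x ∷ map f xs)             ≡⟨ splitAt-∷-++ (f M) (f x) (map f xs) (map f b) (concatMap F bs) ih ⟩
  concatMap F ((x ∷ b) ∷ bs)                 ≡⟨ cong (concatMap F ∘ consFirst x) eq ⟨
  concatMap F (consFirst x (splitAt M xs))   ≡⟨ cong (concatMap F) (splitAt-∷-≢ xs x≢M) ⟨
  concatMap F (splitAt M (x ∷ xs))           ∎
  where
  open ≡-Reasoning
  F = splitAt (f M) ∘ map f
  ih : splitAt (f M) (map f xs) ≡ F b ++ concatMap F bs
  ih = trans (splitAt-map f M xs) (cong (concatMap F) eq)

splitAt-map-injective : ∀ f M xs → (∀ {y} → y ∈ xs → f y ≡ f M → y ≡ M) →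
                        splitAt (f M) (map f xs) ≡ map (map f) (splitAt M xs)
splitAt-map-injective f M xs inj = begin
  splitAt (f M) (map f xs)                          ≡⟨ splitAt-map f M xs ⟩
  concat (map (splitAt (f M) ∘ map f) (splitAt M xs)) ≡⟨ cong concat (map-cong-local (All.tabulate single)) ⟩
  concat (map ([_] ∘ map f) (splitAt M xs))         ≡⟨ cong concat (map-∘ (splitAt M xs)) ⟩
  concat (map [_] (map (map f) (splitAt M xs)))     ≡⟨ concat-map-[ map (map f) (splitAt M xs) ] ⟩
  map (map f) (splitAt M xs)                        ∎
  where
  open ≡-Reasoning
  single : ∀ {B} → B ∈ splitAt M xs → splitAt (f M) (map f B) ≡ [ map f B ]
  single B∈ = splitAt-∉ _ fM∉
    where
    fM∉ : f M ∉ map f _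
    fM∉ fM∈ with ∈-splitAt⁻ xs B∈ | ∈-map⁻ f fM∈
    ... | B⊆xs , M∉B | y , y∈B , fM≡fy = M∉B (subst (_∈ _) (inj (Any-resp-⊆ B⊆xs y∈B) (sym fM≡fy)) y∈B)


-- The tree of a word

-- Γraw with the cut value taken to be the maximum rather than r ∸ 1, which makes it
-- invariant under order embeddings.
tree : ℕ → List ℕ → Tree
tree _       []       = leaf
tree zero    (_ ∷ _)  = leaf
tree (suc f) (x ∷ xs) = mkNode (map (tree f) (splitAt (max (x ∷ xs)) (x ∷ xs)))

tree-fuel : ∀ f g xs → length xs ≤ f → length xs ≤ g → tree f xs ≡ tree g xs
tree-fuel _       _       []       _  _  = refl
tree-fuel (suc f) (suc g) (x ∷ xs) xs≤f xs≤g = cong mkNode (map-cong-local (All.tabulate λ {B} B∈ →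
  tree-fuel f g B (∈-splitAt⇒length≤ (max∈ x xs) B∈ xs≤f) (∈-splitAt⇒length≤ (max∈ x xs) B∈ xs≤g)))

tree-suc : ∀ f {v} xs → v ∈ xs → All (_≤ v) xs → tree (suc f) xs ≡ mkNode (map (tree f) (splitAt v xs))
tree-suc f (x ∷ xs) v∈xs xs≤v = cong (λ M → mkNode (map (tree f) (splitAt M (x ∷ xs)))) (max≡ v∈xs xs≤v)

tree-splitAt : ∀ f {v} xs → All (_≤ v) xs → length xs ≤ f → tree f xs ≡ mkNode (map (tree f) (splitAt v xs))
tree-splitAt f {v} xs xs≤v xs≤f with v ∈? xs
... | no v∉xs = cong (mkNode ∘ map (tree f)) (sym (splitAt-∉ xs v∉xs))
tree-splitAt zero    (_ ∷ _) _ () | yes _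
tree-splitAt (suc f) {v} xs xs≤v xs≤f | yes v∈xs = begin
  tree (suc f) xs                               ≡⟨ tree-suc f xs v∈xs xs≤v ⟩
  mkNode (map (tree f) (splitAt v xs))          ≡⟨ cong mkNode (map-cong-local (All.tabulate more-fuel)) ⟩
  mkNode (map (tree (suc f)) (splitAt v xs))    ∎
  where
  open ≡-Reasoning
  more-fuel : ∀ {B} → B ∈ splitAt v xs → tree f B ≡ tree (suc f) B
  more-fuel {B} B∈ = let B≤f = ∈-splitAt⇒length≤ v∈xs B∈ xs≤f in
                     tree-fuel f (suc f) B B≤f (m≤n⇒m≤1+n B≤f)

tree-suc-occurrence : ∀ f {v} P Q → All (_≤ v) (P ++ v ∷ Q) →
                      tree (suc f) (P ++ v ∷ Q) ≡ mkNode (map (tree f) (splitAt v P) ++ map (tree f) (splitAt v Q))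
tree-suc-occurrence f {v} P Q bound = begin
  tree (suc f) (P ++ v ∷ Q)
    ≡⟨ tree-suc f (P ++ v ∷ Q) (∈-++⁺ʳ P (here refl)) bound ⟩
  mkNode (map (tree f) (splitAt v (P ++ v ∷ Q)))
    ≡⟨ cong (mkNode ∘ map (tree f)) (splitAt-++-∷ v P Q) ⟩
  mkNode (map (tree f) (splitAt v P ++ splitAt v Q))
    ≡⟨ cong mkNode (map-++ (tree f) (splitAt v P) (splitAt v Q)) ⟩
  mkNode (map (tree f) (splitAt v P) ++ map (tree f) (splitAt v Q))
    ∎
  where open ≡-Reasoning

tree-suc-map : ∀ f {g} x xs → g Preserves _≤_ ⟶ _≤_ →
               (∀ {y} → y ∈ x ∷ xs → g y ≡ g (max (x ∷ xs)) → y ≡ max (x ∷ xs)) →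
               tree (suc f) (map g (x ∷ xs)) ≡ mkNode (map (tree f ∘ map g) (splitAt (max (x ∷ xs)) (x ∷ xs)))
tree-suc-map f {g} x xs mono inj = begin
  mkNode (map (tree f) (splitAt (max (map g ys)) (map g ys)))
    ≡⟨ cong (λ v → mkNode (map (tree f) (splitAt v (map g ys)))) (max-map mono x xs) ⟩
  mkNode (map (tree f) (splitAt (g M) (map g ys)))
    ≡⟨ cong (mkNode ∘ map (tree f)) (splitAt-map-injective g M ys inj) ⟩
  mkNode (map (tree f) (map (map g) (splitAt M ys)))
    ≡⟨ cong mkNode (map-∘ (splitAt M ys)) ⟨
  mkNode (map (tree f ∘ map g) (splitAt M ys))
    ∎
  where
  open ≡-Reasoning
  ys = x ∷ xs
  M = max ys

tree-map-embedding : ∀ f {g} xs → g Preserves _≤_ ⟶ _≤_ → InjectiveOn g xs → tree f (map g xs) ≡ tree f xs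
tree-map-embedding _       []       _    _   = refl
tree-map-embedding zero    (_ ∷ _)  _    _   = refl
tree-map-embedding (suc f) (x ∷ xs) mono inj =
  trans (tree-suc-map f x xs mono (λ y∈ → inj y∈ (max∈ x xs)))
        (cong mkNode (map-cong-local (All.tabulate λ {B} B∈ →
          let B⊆ , _ = ∈-splitAt⁻ (x ∷ xs) B∈ in
          tree-map-embedding f B mono λ p q → inj (Any-resp-⊆ B⊆ p) (Any-resp-⊆ B⊆ q))))

-- Standardisation

rank-suc : ∀ b x → rank b (suc x) ≡ rank b x + length (filter (_∈? b) [ x ])
rank-suc b x = begin
  length (filter (_∈? b) (upTo (suc x)))                       ≡⟨ cong (length ∘ filter (_∈? b)) (upTo-∷ʳ x) ⟨
  length (filter (_∈? b) (upTo x ++ [ x ]))                    ≡⟨ cong length (filter-++ (_∈? b) (upTo x) [ x ]) ⟩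
  length (filter (_∈? b) (upTo x) ++ filter (_∈? b) [ x ])     ≡⟨ length-++ (filter (_∈? b) (upTo x)) ⟩
  rank b x + length (filter (_∈? b) [ x ])                     ∎
  where open ≡-Reasoning

rank-suc-∈ : ∀ b {x} → x ∈ b → rank b (suc x) ≡ suc (rank b x)
rank-suc-∈ b {x} x∈b = begin
  rank b (suc x)                             ≡⟨ rank-suc b x ⟩
  rank b x + length (filter (_∈? b) [ x ])   ≡⟨ cong (λ l → rank b x + length l) (filter-accept (_∈? b) x∈b) ⟩
  rank b x + 1                               ≡⟨ +-comm (rank b x) 1 ⟩
  suc (rank b x)                             ∎
  where open ≡-Reasoning

rank-mono : ∀ b → rank b Preserves _≤_ ⟶ _≤_
rank-mono b {x} x≤y with ≤⇒≤′ x≤y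
... | ℕ.≤′-refl     = ≤-refl
... | ℕ.≤′-step {y} x≤′y =
  ≤-trans (rank-mono b (≤′⇒≤ x≤′y)) (subst (rank b y ≤_) (sym (rank-suc b y)) (m≤m+n (rank b y) _))

rank-< : ∀ b {x y} → x ∈ b → x < y → rank b x < rank b y
rank-< b x∈b x<y = ≤-trans (≤-reflexive (sym (rank-suc-∈ b x∈b))) (rank-mono b x<y)

rank-injective : ∀ b → InjectiveOn (rank b) b
rank-injective b {x} {y} x∈b y∈b eq with <-cmp x y
... | tri< x<y _ _ = contradiction eq (<⇒≢ (rank-< b x∈b x<y))
... | tri≈ _ x≡y _ = x≡y
... | tri> _ _ y<x = contradiction (sym eq) (<⇒≢ (rank-< b y∈b y<x))

imgSize∸1≡max-std : ∀ b → imgSize b ∸ 1 ≡ max (std b)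
imgSize∸1≡max-std []       = refl
imgSize∸1≡max-std (x ∷ xs) = begin
  rank (x ∷ xs) (suc (max (x ∷ xs))) ∸ 1   ≡⟨ cong (_∸ 1) (rank-suc-∈ (x ∷ xs) (max∈ x xs)) ⟩
  rank (x ∷ xs) (max (x ∷ xs))             ≡⟨ max-map (rank-mono (x ∷ xs)) x xs ⟨
  max (std (x ∷ xs))                       ∎
  where open ≡-Reasoning

Γraw≡tree : ∀ f r xs → r ∸ 1 ≡ max xs → Γraw f r xs ≡ tree f xs
Γraw≡tree _       _ []       _  = refl
Γraw≡tree zero    _ (_ ∷ _)  _  = refl
Γraw≡tree (suc f) r (x ∷ xs) eq = cong mkNode (begin
  map Γraw-std (splitAt (r ∸ 1) (x ∷ xs))          ≡⟨ cong (λ v → map Γraw-std (splitAt v (x ∷ xs))) eq ⟩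
  map Γraw-std (splitAt (max (x ∷ xs)) (x ∷ xs))   ≡⟨ map-cong standardise _ ⟩
  map (tree f) (splitAt (max (x ∷ xs)) (x ∷ xs))   ∎)
  where
  open ≡-Reasoning
  Γraw-std : List ℕ → Tree
  Γraw-std b = Γraw f (imgSize b) (std b)
  standardise : ∀ b → Γraw-std b ≡ tree f b
  standardise b = trans (Γraw≡tree f (imgSize b) (std b) (imgSize∸1≡max-std b))
                        (tree-map-embedding f b (rank-mono b) (rank-injective b))


-- Relations on trees

node-≡ : ∀ {ts us} → ts ≡ us → .(p : 2 ≤ length ts) .(q : 2 ≤ length us) → node ts p ≡ node us q
node-≡ refl _ _ = refl

mkNode≡node : ∀ ts (p : 2 ≤ length ts) → mkNode ts ≡ node ts p
mkNode≡node (a ∷ b ∷ ts) _ = refl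
mkNode≡node (a ∷ [])     (s≤s ())

2≤length-++-∷ : ∀ {A : Set} (pre : List A) {a b} post →
                2 ≤ length (pre ++ a ∷ post) → 2 ≤ length (pre ++ b ∷ post)
2≤length-++-∷ pre post = subst (2 ≤_) (trans (length-++ pre) (sym (length-++ pre)))

2≤length-++-assoc : ∀ {A : Set} (pre mid post : List A) →
                    2 ≤ length (pre ++ mid ++ post) → 2 ≤ length ((pre ++ mid) ++ post)
2≤length-++-assoc pre mid post = subst (λ l → 2 ≤ length l) (sym (++-assoc pre mid post))

record Congruence (_∼_ : Tree → Tree → Set) : Set where
  field
    ∼-refl  : ∀ {a} → a ∼ a
    ∼-trans : ∀ {a b c} → a ∼ b → b ∼ c → a ∼ c
    ∼-cong  : ∀ pre {a b} post .q .r → a ∼ b → node (pre ++ a ∷ post) q ∼ node (pre ++ b ∷ post) r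

  ∼-reflexive : ∀ {a b} → a ≡ b → a ∼ b
  ∼-reflexive refl = ∼-refl

  children-cong : ∀ {A : Set} (g h : A → Tree) pre bs → (∀ {B} → B ∈ bs → g B ∼ h B) →
                  (p : 2 ≤ length (pre ++ map g bs)) (q : 2 ≤ length (pre ++ map h bs)) →
                  node (pre ++ map g bs) p ∼ node (pre ++ map h bs) q
  children-cong g h pre []       _  _ _ = ∼-refl
  children-cong g h pre (B ∷ bs) gh p q = ∼-trans (∼-cong pre (map g bs) p p′ (gh (here refl)))
    (subst₂ _∼_ (node-≡ (++-assoc pre [ h B ] (map g bs)) p″ p′) (node-≡ (++-assoc pre [ h B ] (map h bs)) q″ q)
      (children-cong g h (pre ++ [ h B ]) bs (gh ∘ there) p″ q″))
    where
    p′ = 2≤length-++-∷ pre (map g bs) p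
    p″ = 2≤length-++-assoc pre [ h B ] (map g bs) p′
    q″ = 2≤length-++-assoc pre [ h B ] (map h bs) q

  mkNode-map-cong : ∀ {A : Set} (g h : A → Tree) bs → (∀ {B} → B ∈ bs → g B ∼ h B) →
                    mkNode (map g bs) ∼ mkNode (map h bs)
  mkNode-map-cong g h []           gh = ∼-refl
  mkNode-map-cong g h (B ∷ [])     gh = gh (here refl)
  mkNode-map-cong g h (B ∷ C ∷ bs) gh = children-cong g h [] (B ∷ C ∷ bs) gh (s≤s (s≤s z≤n)) (s≤s (s≤s z≤n))

⊆T-cong : ∀ pre {a b} post .q .r → a ⊆T b → node (pre ++ a ∷ post) q ⊆T node (pre ++ b ∷ post) r
⊆T-cong pre post q r ε = ε
⊆T-cong pre post q r (a↝b ◅ b⊆c) =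
  contract-there pre post q (2≤length-++-∷ pre post q) a↝b ◅ ⊆T-cong pre post (2≤length-++-∷ pre post q) r b⊆c

⊆T-congruence : Congruence _⊆T_
⊆T-congruence = record { ∼-refl = ε ; ∼-trans = _◅◅_ ; ∼-cong = ⊆T-cong }

≤BT-congruence : Congruence _≤BT_
≤BT-congruence = record { ∼-refl = ≤BT-refl ; ∼-trans = ≤BT-trans ; ∼-cong = ≤BT-cong }

≥BT-congruence : Congruence (flip _≤BT_)
≥BT-congruence = record
  { ∼-refl  = ≤BT-refl
  ; ∼-trans = flip ≤BT-trans
  ; ∼-cong  = λ pre post q r → ≤BT-cong pre post r q
  }

flatten : ∀ pre tss → All (_≢ []) tss →
          (p : 2 ≤ length (pre ++ map mkNode tss)) (q : 2 ≤ length (pre ++ concat tss)) →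
          node (pre ++ map mkNode tss) p ⊆T node (pre ++ concat tss) q
flatten pre []                   _             _ _ = ε
flatten pre ([] ∷ tss)           (ts≢[] ∷ _)   _ _ = contradiction refl ts≢[]
flatten pre ((a ∷ []) ∷ tss)     (_ ∷ tss≢[]) p q =
  subst₂ _⊆T_ (node-≡ (++-assoc pre [ a ] (map mkNode tss)) p′ p) (node-≡ (++-assoc pre [ a ] (concat tss)) q′ q)
    (flatten (pre ++ [ a ]) tss tss≢[] p′ q′)
  where
  p′ = 2≤length-++-assoc pre [ a ] (map mkNode tss) p
  q′ = 2≤length-++-assoc pre [ a ] (concat tss) q
flatten pre (ts@(_ ∷ _ ∷ _) ∷ tss) (_ ∷ tss≢[]) p q =
  contract-here pre ts (map mkNode tss) (s≤s (s≤s z≤n)) p r ◅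
  subst₂ _⊆T_ (node-≡ (++-assoc pre ts (map mkNode tss)) r′ r) (node-≡ (++-assoc pre ts (concat tss)) q′ q)
    (flatten (pre ++ ts) tss tss≢[] r′ q′)
  where
  r  = ≤-trans (s≤s (s≤s z≤n)) (≤-trans (length-++-≤ˡ ts) (length-++-≤ʳ (ts ++ map mkNode tss) {pre}))
  r′ = 2≤length-++-assoc pre ts (map mkNode tss) r
  q′ = 2≤length-++-assoc pre ts (concat tss) q

mkNode-flatten : ∀ tss → 2 ≤ length tss → All (_≢ []) tss → mkNode (map mkNode tss) ⊆T mkNode (concat tss)
mkNode-flatten tss p tss≢[] = subst₂ _⊆T_ (sym (mkNode≡node _ p′)) (sym (mkNode≡node _ q))
  (flatten [] tss tss≢[] p′ q)
  where
  p′ = subst (2 ≤_) (sym (length-map mkNode tss)) p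
  q  = ≤-trans p (length≤length-concat tss≢[])

mkNode-merge : ∀ ts w ws → 2 ≤ length ts → mkNode (mkNode ts ∷ w ∷ ws) ≤BT mkNode (ts ++ w ∷ ws)
mkNode-merge ts w ws p = subst₂ _≤BT_
  (cong (λ t → mkNode (t ∷ w ∷ ws)) (sym (mkNode≡node ts p))) (sym (mkNode≡node _ q))
  (merge ts w ws p (s≤s (s≤s z≤n)) q)
  where
  q = ≤-trans p (length-++-≤ˡ ts)

mkNode-split : ∀ x xs suf → 2 ≤ length suf → mkNode ((x ∷ xs) ++ suf) ≤BT mkNode ((x ∷ xs) ++ [ mkNode suf ])
mkNode-split x xs suf p = subst₂ _≤BT_
  (sym (mkNode≡node _ q))
  (sym (trans (cong (λ t → mkNode ((x ∷ xs) ++ [ t ])) (mkNode≡node suf p)) (mkNode≡node _ r)))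
  (split x xs suf q p r)
  where
  q = ≤-trans p (length-++-≤ʳ suf {x ∷ xs})
  r = s≤s (≤-trans (s≤s z≤n) (length-++-≤ʳ [ _ ] {xs}))


tree-map-⊆T : ∀ f xs {ρ} → ρ Preserves _≤_ ⟶ _≤_ → length xs ≤ f → tree f xs ⊆T tree f (map ρ xs)
tree-map-⊆T _       []       _    _    = ε
tree-map-⊆T (suc f) (x ∷ xs) {ρ} mono xs≤f = begin
  mkNode (map (tree f) bs)
    ⟶*⟨ mkNode-map-cong (tree f) (tree f ∘ map ρ) bs (λ {B} B∈ → tree-map-⊆T f B mono (length-block B∈)) ⟩
  mkNode (map (tree f ∘ map ρ) bs)
    ≡⟨ cong mkNode (map-cong-local (All.tabulate unfold-block)) ⟩
  mkNode (map (mkNode ∘ children) bs)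
    ≡⟨ cong mkNode (map-∘ bs) ⟩
  mkNode (map mkNode (map children bs))
    ⟶*⟨ mkNode-flatten (map children bs) many-blocks (All.tabulate nonempty-children) ⟩
  mkNode (concat (map children bs))
    ≡⟨ cong (mkNode ∘ concat) (map-∘ bs) ⟩
  mkNode (concat (map (map (tree f)) (map F bs)))
    ≡⟨ cong mkNode (concat-map (map F bs)) ⟩
  mkNode (map (tree f) (concatMap F bs))
    ≡⟨ cong (mkNode ∘ map (tree f)) (splitAt-map ρ M ys) ⟨
  mkNode (map (tree f) (splitAt (ρ M) (map ρ ys)))
    ≡⟨ cong (λ v → mkNode (map (tree f) (splitAt v (map ρ ys)))) (max-map mono x xs) ⟨
  tree (suc f) (map ρ ys)
    ∎
  where
  open StarReasoning Contract
  open Congruence ⊆T-congruence using (mkNode-map-cong)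
  ys = x ∷ xs
  M  = max ys
  bs = splitAt M ys
  F  = splitAt (ρ M) ∘ map ρ
  children : List ℕ → List Tree
  children = map (tree f) ∘ F
  length-block : ∀ {B} → B ∈ bs → length B ≤ f
  length-block = λ B∈ → ∈-splitAt⇒length≤ (max∈ x xs) B∈ xs≤f
  unfold-block : ∀ {B} → B ∈ bs → tree f (map ρ B) ≡ mkNode (children B)
  unfold-block {B} B∈ = tree-splitAt f (map ρ B)
    (Allₚ.map⁺ (All.map mono (All-resp-⊆ (proj₁ (∈-splitAt⁻ ys B∈)) (xs≤max ys))))
    (subst (_≤ f) (sym (length-map ρ B)) (length-block B∈))
  many-blocks : 2 ≤ length (map children bs)
  many-blocks = subst (2 ≤_) (sym (length-map children bs)) (splitAt-length (max∈ x xs))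
  nonempty-children : ∀ {C} → C ∈ map children bs → C ≢ []
  nonempty-children C∈ with ∈-map⁻ children C∈
  ... | B , _ , refl with splitAt (ρ M) (map ρ B) | splitAt-nonempty (ρ M) (map ρ B)
  ... | _ ∷ _ | _ = λ ()


-- Bruhat steps

tℕ : ℕ → ℕ → ℕ
tℕ _       zero    = zero
tℕ zero    (suc j) = j
tℕ (suc i) (suc j) = suc (tℕ i j)

tℕ-≤ : ∀ {i j} → j ≤ i → tℕ i j ≡ j
tℕ-≤ {j = zero}  _         = refl
tℕ-≤ {suc i} {suc j} (s≤s j≤i) = cong suc (tℕ-≤ j≤i)

tℕ-suc : ∀ {i j} → i ≤ j → tℕ i (suc j) ≡ j
tℕ-suc {zero}  _         = refl
tℕ-suc {suc i} {suc j} (s≤s i≤j) = cong suc (tℕ-suc i≤j)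

tℕ-mono : ∀ i → tℕ i Preserves _≤_ ⟶ _≤_
tℕ-mono i       {zero}           _         = z≤n
tℕ-mono zero    {suc x} {suc y} (s≤s x≤y) = x≤y
tℕ-mono (suc i) {suc x} {suc y} (s≤s x≤y) = s≤s (tℕ-mono i x≤y)

tℕ-≤-top : ∀ i {y} → y ≤ suc i → tℕ i y ≤ i
tℕ-≤-top i {y} y≤ = subst (tℕ i y ≤_) (tℕ-suc ≤-refl) (tℕ-mono i y≤)

tℕ-collision : ∀ i {x y} → tℕ i x ≡ tℕ i y → x ≡ y ⊎ (x ≡ i × y ≡ suc i) ⊎ (x ≡ suc i × y ≡ i)
tℕ-collision i       {zero}  {zero}  _  = inj₁ refl
tℕ-collision zero    {zero}  {suc y} eq = inj₂ (inj₁ (refl , cong suc (sym eq)))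
tℕ-collision zero    {suc x} {zero}  eq = inj₂ (inj₂ (cong suc eq , refl))
tℕ-collision zero    {suc x} {suc y} eq = inj₁ (cong suc eq)
tℕ-collision (suc i) {suc x} {suc y} eq with tℕ-collision i (suc-injective eq)
... | inj₁ x≡y                = inj₁ (cong suc x≡y)
... | inj₂ (inj₁ (x≡ , y≡)) = inj₂ (inj₁ (cong suc x≡ , cong suc y≡))
... | inj₂ (inj₂ (x≡ , y≡)) = inj₂ (inj₂ (cong suc x≡ , cong suc y≡))

tℕ-injectiveOn : ∀ i {xs} → i ∉ xs ⊎ suc i ∉ xs → InjectiveOn (tℕ i) xs
tℕ-injectiveOn i missing x∈ y∈ eq with tℕ-collision i eq | missing
... | inj₁ x≡y                  | _        = x≡y
... | inj₂ (inj₁ (refl , _))    | inj₁ i∉  = contradiction x∈ i∉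
... | inj₂ (inj₁ (_ , refl))    | inj₂ si∉ = contradiction y∈ si∉
... | inj₂ (inj₂ (_ , refl))    | inj₁ i∉  = contradiction y∈ i∉
... | inj₂ (inj₂ (refl , _))    | inj₂ si∉ = contradiction x∈ si∉

tree-tℕ-missing : ∀ f i ys → i ∉ ys ⊎ suc i ∉ ys → tree f (map (tℕ i) ys) ≡ tree f ys
tree-tℕ-missing f i ys missing = tree-map-embedding f ys (tℕ-mono i) (tℕ-injectiveOn i missing)

map-tℕ-below : ∀ i {P} → All (_≤ i) P → map (tℕ i) P ≡ P
map-tℕ-below i P≤i = map-id-local (All.map tℕ-≤ P≤i)

tree-tℕ-occurrence : ∀ f i P Q → All (_≤ suc i) (P ++ suc i ∷ Q) →
                     tree (suc f) (map (tℕ i) (P ++ suc i ∷ Q)) ≡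
                     mkNode (map (tree f) (splitAt i (map (tℕ i) P)) ++ map (tree f) (splitAt i (map (tℕ i) Q)))
tree-tℕ-occurrence f i P Q bound =
  trans (cong (tree (suc f)) map-eq)
        (tree-suc-occurrence f (map (tℕ i) P) (map (tℕ i) Q)
          (subst (All (_≤ i)) map-eq (Allₚ.map⁺ (All.map (tℕ-≤-top i) bound))))
  where
  map-eq : map (tℕ i) (P ++ suc i ∷ Q) ≡ map (tℕ i) P ++ i ∷ map (tℕ i) Q
  map-eq = trans (map-++ (tℕ i) P (suc i ∷ Q)) (cong (λ j → map (tℕ i) P ++ j ∷ map (tℕ i) Q) (tℕ-suc ≤-refl))

splitAt-tℕ-top : ∀ i Q → i ∉ Q → All (_≤ suc i) Q → splitAt i (map (tℕ i) Q) ≡ splitAt (suc i) Q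
splitAt-tℕ-top i Q i∉Q Q≤ = begin
  splitAt i (map (tℕ i) Q)                ≡⟨ cong (λ v → splitAt v (map (tℕ i) Q)) (tℕ-suc ≤-refl) ⟨
  splitAt (tℕ i (suc i)) (map (tℕ i) Q)   ≡⟨ splitAt-map-injective (tℕ i) (suc i) Q
                                               (λ y∈ → tℕ-injective′ (there y∈) (here refl)) ⟩
  map (map (tℕ i)) (splitAt (suc i) Q)    ≡⟨ map-id-local (All.tabulate λ B∈ → map-tℕ-below i (block≤i B∈)) ⟩
  splitAt (suc i) Q                       ∎
  where
  open ≡-Reasoning
  tℕ-injective′ : InjectiveOn (tℕ i) (suc i ∷ Q)
  tℕ-injective′ = tℕ-injectiveOn i (inj₁ (∉-∷ 1+n≢n i∉Q))
  block≤i : ∀ {B} → B ∈ splitAt (suc i) Q → All (_≤ i) B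
  block≤i B∈ = let B⊆Q , si∉B = ∈-splitAt⁻ Q B∈ in All≤-pred (All-resp-⊆ B⊆Q Q≤) si∉B

AllBefore : ℕ → ℕ → List ℕ → Set
AllBefore a b []       = ⊤
AllBefore a b (x ∷ xs) = (x ≡ b → a ∉ xs) × AllBefore a b xs

AllBefore-⊆ : ∀ {a b xs ys} → xs ⊆ ys → AllBefore a b ys → AllBefore a b xs
AllBefore-⊆ []         _              = tt
AllBefore-⊆ (_ ∷ʳ τ)   (_ , before)   = AllBefore-⊆ τ before
AllBefore-⊆ (refl ∷ τ) (here′ , before) = (λ x≡b a∈ → here′ x≡b (Any-resp-⊆ τ a∈)) , AllBefore-⊆ τ before

AllBefore⇒∉-after : ∀ {a b} P Q → AllBefore a b (P ++ b ∷ Q) → a ∉ Q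
AllBefore⇒∉-after []      Q (b-first , _) = b-first refl
AllBefore⇒∉-after (_ ∷ P) Q (_ , before)  = AllBefore⇒∉-after P Q before

AllBefore⇒∉-before : ∀ {a b} P Q → AllBefore a b (P ++ a ∷ Q) → b ∉ P
AllBefore⇒∉-before (_ ∷ P) Q (b-first , _) (here refl) = b-first refl (∈-++⁺ʳ P (here refl))
AllBefore⇒∉-before (_ ∷ P) Q (_ , before)  (there b∈) = AllBefore⇒∉-before P Q before b∈

tree-tℕ-up-at-max : ∀ i f ys → length ys ≤ suc f → AllBefore i (suc i) ys →
                    i ∈ ys → suc i ∈ ys → All (_≤ suc i) ys →
                    tree (suc f) ys ≤BT tree (suc f) (map (tℕ i) ys)
tree-tℕ-up-at-max i f ys ys≤ before i∈ si∈ bound with first-occurrence si∈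
... | P , Q , refl , si∉P with splitAt-nonempty (suc i) Q
...   | q , qs , splitQ = subst₂ _≤BT_ (sym lhs) (sym rhs) (mkNode-merge ts (tree f q) (map (tree f) qs) many)
  where
  open ≡-Reasoning
  i∉Q : i ∉ Q
  i∉Q = AllBefore⇒∉-after P Q before
  i∈P : i ∈ P
  i∈P = [ id , flip contradiction i∉Q ]′ (∈-++-∷⁻ P i∈ (1+n≢n ∘ sym))
  P≤i : All (_≤ i) P
  P≤i = All≤-pred (Allₚ.++⁻ˡ P bound) si∉P
  ts = map (tree f) (splitAt i P)
  many : 2 ≤ length ts
  many = subst (2 ≤_) (sym (length-map (tree f) (splitAt i P))) (splitAt-length i∈P)
  lhs : tree (suc f) (P ++ suc i ∷ Q) ≡ mkNode (mkNode ts ∷ tree f q ∷ map (tree f) qs)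
  lhs = begin
    tree (suc f) (P ++ suc i ∷ Q)
      ≡⟨ tree-suc-occurrence f P Q bound ⟩
    mkNode (map (tree f) (splitAt (suc i) P) ++ map (tree f) (splitAt (suc i) Q))
      ≡⟨ cong₂ (λ l r → mkNode (map (tree f) l ++ map (tree f) r)) (splitAt-∉ P si∉P) splitQ ⟩
    mkNode (tree f P ∷ tree f q ∷ map (tree f) qs)
      ≡⟨ cong (λ t → mkNode (t ∷ tree f q ∷ map (tree f) qs))
              (tree-splitAt f P P≤i (≤-pred (≤-trans (length-++-∷-<ˡ P) ys≤))) ⟩
    mkNode (mkNode ts ∷ tree f q ∷ map (tree f) qs)
      ∎
  rhs : tree (suc f) (map (tℕ i) (P ++ suc i ∷ Q)) ≡ mkNode (ts ++ tree f q ∷ map (tree f) qs)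
  rhs = begin
    tree (suc f) (map (tℕ i) (P ++ suc i ∷ Q))
      ≡⟨ tree-tℕ-occurrence f i P Q bound ⟩
    mkNode (map (tree f) (splitAt i (map (tℕ i) P)) ++ map (tree f) (splitAt i (map (tℕ i) Q)))
      ≡⟨ cong₂ (λ l r → mkNode (map (tree f) (splitAt i l) ++ map (tree f) r))
               (map-tℕ-below i P≤i)
               (trans (splitAt-tℕ-top i Q i∉Q (All.tail (Allₚ.++⁻ʳ P bound))) splitQ) ⟩
    mkNode (ts ++ tree f q ∷ map (tree f) qs)
      ∎

tree-tℕ-down-at-max : ∀ i f ys → length ys ≤ suc f → AllBefore (suc i) i ys →
                      i ∈ ys → suc i ∈ ys → All (_≤ suc i) ys →
                      tree (suc f) (map (tℕ i) ys) ≤BT tree (suc f) ys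
tree-tℕ-down-at-max i f ys ys≤ before i∈ si∈ bound with last-occurrence si∈
... | P , Q , refl , si∉Q with splitAt-nonempty (suc i) P
...   | p , ps , splitP = subst₂ _≤BT_ (sym lhs) (sym rhs) (mkNode-split (tree f p) (map (tree f) ps) suf many)
  where
  open ≡-Reasoning
  i∉P : i ∉ P
  i∉P = AllBefore⇒∉-before P Q before
  i∈Q : i ∈ Q
  i∈Q = [ flip contradiction i∉P , id ]′ (∈-++-∷⁻ P i∈ (1+n≢n ∘ sym))
  Q≤i : All (_≤ i) Q
  Q≤i = All≤-pred (All.tail (Allₚ.++⁻ʳ P bound)) si∉Q
  pre = tree f p ∷ map (tree f) ps
  suf = map (tree f) (splitAt i Q)
  many : 2 ≤ length suf
  many = subst (2 ≤_) (sym (length-map (tree f) (splitAt i Q))) (splitAt-length i∈Q)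
  lhs : tree (suc f) (map (tℕ i) (P ++ suc i ∷ Q)) ≡ mkNode (pre ++ suf)
  lhs = begin
    tree (suc f) (map (tℕ i) (P ++ suc i ∷ Q))
      ≡⟨ tree-tℕ-occurrence f i P Q bound ⟩
    mkNode (map (tree f) (splitAt i (map (tℕ i) P)) ++ map (tree f) (splitAt i (map (tℕ i) Q)))
      ≡⟨ cong₂ (λ l r → mkNode (map (tree f) l ++ map (tree f) (splitAt i r)))
               (trans (splitAt-tℕ-top i P i∉P (Allₚ.++⁻ˡ P bound)) splitP)
               (map-tℕ-below i Q≤i) ⟩
    mkNode (pre ++ suf)
      ∎
  rhs : tree (suc f) (P ++ suc i ∷ Q) ≡ mkNode (pre ++ [ mkNode suf ])
  rhs = begin
    tree (suc f) (P ++ suc i ∷ Q)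
      ≡⟨ tree-suc-occurrence f P Q bound ⟩
    mkNode (map (tree f) (splitAt (suc i) P) ++ map (tree f) (splitAt (suc i) Q))
      ≡⟨ cong₂ (λ l r → mkNode (map (tree f) l ++ map (tree f) r)) splitP (splitAt-∉ Q si∉Q) ⟩
    mkNode (pre ++ [ tree f Q ])
      ≡⟨ cong (λ t → mkNode (pre ++ [ t ]))
              (tree-splitAt f Q Q≤i (≤-pred (≤-trans (length-++-∷-<ʳ P) ys≤))) ⟩
    mkNode (pre ++ [ mkNode suf ])
      ∎

-- Shared by the up and down steps (≤BT and its converse), which differ only where suc i is
-- the maximum.
module _ (i : ℕ) {_∼_ : Tree → Tree → Set} (C : Congruence _∼_) (Cond : List ℕ → Set)
         (Cond-⊆ : ∀ {B ys} → B ⊆ ys → Cond ys → Cond B)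
         (at-max : ∀ f ys → length ys ≤ suc f → Cond ys → i ∈ ys → suc i ∈ ys → All (_≤ suc i) ys →
                tree (suc f) ys ∼ tree (suc f) (map (tℕ i) ys)) where
  open Congruence C

  tree-tℕ : ∀ f ys → length ys ≤ f → Cond ys → tree f ys ∼ tree f (map (tℕ i) ys)
  tree-tℕ _       []       _   _    = ∼-refl
  tree-tℕ (suc f) (x ∷ xs) ys≤ cond with i ∈? x ∷ xs | suc i ∈? x ∷ xs
  ... | no i∉  | _      = ∼-reflexive (sym (tree-tℕ-missing (suc f) i (x ∷ xs) (inj₁ i∉)))
  ... | yes _  | no si∉ = ∼-reflexive (sym (tree-tℕ-missing (suc f) i (x ∷ xs) (inj₂ si∉)))
  ... | yes i∈ | yes si∈ with max (x ∷ xs) ≟ suc i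
  ...   | yes M≡ = at-max f (x ∷ xs) ys≤ cond i∈ si∈ (subst (λ m → All (_≤ m) (x ∷ xs)) M≡ (xs≤max (x ∷ xs)))
  ...   | no M≢  = subst (tree (suc f) (x ∷ xs) ∼_) (sym (tree-suc-map f x xs (tℕ-mono i) injective-at-max))
                     (mkNode-map-cong (tree f) (tree f ∘ map (tℕ i)) (splitAt (max (x ∷ xs)) (x ∷ xs)) λ {B} B∈ →
                       tree-tℕ f B (∈-splitAt⇒length≤ (max∈ x xs) B∈ ys≤)
                                   (Cond-⊆ (proj₁ (∈-splitAt⁻ (x ∷ xs) B∈)) cond))
    where
    injective-at-max : ∀ {y} → y ∈ x ∷ xs → tℕ i y ≡ tℕ i (max (x ∷ xs)) → y ≡ max (x ∷ xs)
    injective-at-max _ eq with tℕ-collision i eq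
    ... | inj₁ y≡M               = y≡M
    ... | inj₂ (inj₁ (_ , M≡si)) = contradiction M≡si M≢
    ... | inj₂ (inj₂ (_ , M≡i))  = contradiction (subst (suc i ≤_) M≡i (∈⇒≤max si∈)) (<-irrefl refl)

tree-tℕ-up : ∀ i f ys → length ys ≤ f → AllBefore i (suc i) ys → tree f ys ≤BT tree f (map (tℕ i) ys)
tree-tℕ-up i = tree-tℕ i ≤BT-congruence (AllBefore i (suc i)) AllBefore-⊆ (tree-tℕ-up-at-max i)

tree-tℕ-down : ∀ i f ys → length ys ≤ f → AllBefore (suc i) i ys → tree f (map (tℕ i) ys) ≤BT tree f ys
tree-tℕ-down i = tree-tℕ i ≥BT-congruence (AllBefore (suc i) i) AllBefore-⊆ (tree-tℕ-down-at-max i)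


-- Surjections as words

values : ∀ {n r} → Vec (Fin r) n → List ℕ
values γ = Vec.toList (Vec.map toℕ γ)

length-values : ∀ {n r} (γ : Vec (Fin r) n) → length (values γ) ≡ n
length-values γ = length-toList (Vec.map toℕ γ)

values≤ : ∀ {n r} (γ : Vec (Fin (suc r)) n) → All (_≤ r) (values γ)
values≤ Vec.[]      = []
values≤ (x Vec.∷ γ) = toℕ≤pred[n] x ∷ values≤ γ

surjective⇒max : ∀ {n r} (γ : Vec (Fin r) n) → IsSurj (r , γ) → r ∸ 1 ≡ max (values γ)
surjective⇒max {r = zero}  Vec.[]         _    = refl
surjective⇒max {r = suc r} γ              surj =
  sym (max≡ (subst (_∈ values γ) (toℕ-fromℕ r) (∈-toList⁺ (∈ᵥ-map⁺ toℕ (surj (fromℕ r))))) (values≤ γ))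

Γ≡tree : ∀ {n r} (γ : Vec (Fin r) n) → IsSurj (r , γ) → Γ (r , γ) ≡ tree n (values γ)
Γ≡tree {n} {r} γ surj = Γraw≡tree n r (values γ) (surjective⇒max γ surj)

clamp : ∀ r → ℕ → Fin (suc r)
clamp zero    _       = Fin.zero
clamp (suc r) zero    = Fin.zero
clamp (suc r) (suc j) = Fin.suc (clamp r j)

clamp-toℕ : ∀ r (x : Fin (suc r)) → clamp r (toℕ x) ≡ x
clamp-toℕ zero    Fin.zero    = refl
clamp-toℕ (suc r) Fin.zero    = refl
clamp-toℕ (suc r) (Fin.suc x) = cong Fin.suc (clamp-toℕ r x)

clamp-mono : ∀ r → (toℕ ∘ clamp r) Preserves _≤_ ⟶ _≤_
clamp-mono zero    _                 = z≤n
clamp-mono (suc r) {zero}          _ = z≤n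
clamp-mono (suc r) {suc a} {suc b} (s≤s a≤b) = s≤s (clamp-mono r a≤b)

values-map : ∀ {n r s} (ρ : Fin (suc r) → Fin s) (γ : Vec (Fin (suc r)) n) →
             values (Vec.map ρ γ) ≡ map (toℕ ∘ ρ ∘ clamp r) (values γ)
values-map ρ Vec.[]                = refl
values-map {r = r} ρ (x Vec.∷ γ) = cong₂ _∷_ (cong (toℕ ∘ ρ) (sym (clamp-toℕ r x))) (values-map ρ γ)

toℕ-t : ∀ {m} (i : Fin (suc m)) (j : Fin (suc (suc m))) → toℕ (t i j) ≡ tℕ (toℕ i) (toℕ j)
toℕ-t i                Fin.zero    = refl
toℕ-t Fin.zero         (Fin.suc j) = refl
toℕ-t {suc m} (Fin.suc i) (Fin.suc j) = cong suc (toℕ-t i j)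

values-t : ∀ {n m} (i : Fin (suc m)) (γ : Vec (Fin (suc (suc m))) n) →
           values (Vec.map (t i) γ) ≡ map (tℕ (toℕ i)) (values γ)
values-t i Vec.[]      = refl
values-t i (x Vec.∷ γ) = cong₂ _∷_ (toℕ-t i x) (values-t i γ)

Γ-t≡tree : ∀ {n m} (i : Fin (suc m)) (γ : Vec (Fin (suc (suc m))) n) → IsSurj (suc (suc m) , γ) →
           Γ (suc m , Vec.map (t i) γ) ≡ tree n (map (tℕ (toℕ i)) (values γ))
Γ-t≡tree {n} {m} i γ surj =
  trans (cong (Γraw n (suc m)) (values-t i γ)) (Γraw≡tree n (suc m) (map (tℕ (toℕ i)) (values γ)) (sym max-eq))
  where
  max-eq : max (map (tℕ (toℕ i)) (values γ)) ≡ m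
  max-eq with values γ | surjective⇒max γ surj
  ... | x ∷ xs | M≡ =
    trans (max-map (tℕ-mono (toℕ i)) x xs) (trans (cong (tℕ (toℕ i)) (sym M≡)) (tℕ-suc (toℕ≤pred[n] i)))

∈-values⇒lookup : ∀ {n r} (γ : Vec (Fin r) n) {a} → toℕ a ∈ values γ → ∃ λ k → lookup γ k ≡ a
∈-values⇒lookup (c Vec.∷ γ) (here eq) = Fin.zero , sym (toℕ-injective eq)
∈-values⇒lookup (c Vec.∷ γ) (there a∈) with ∈-values⇒lookup γ a∈
... | k , eq = Fin.suc k , eq

AllBefore-values : ∀ {n r} (γ : Vec (Fin r) n) (a b : Fin r) →
                   (∀ x y → lookup γ x ≡ a → lookup γ y ≡ b → x Fin.< y) →
                   AllBefore (toℕ a) (toℕ b) (values γ)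
AllBefore-values Vec.[]      a b before = tt
AllBefore-values (c Vec.∷ γ) a b before =
  no-a-later , AllBefore-values γ a b (λ x y ex ey → ≤-pred (before (Fin.suc x) (Fin.suc y) ex ey))
  where
  no-a-later : toℕ c ≡ toℕ b → toℕ a ∉ values γ
  no-a-later c≡b a∈ with ∈-values⇒lookup γ a∈
  ... | k , eq with () ← before (Fin.suc k) Fin.zero eq (toℕ-injective c≡b)

Γ-mono-⊆ : ∀ {n} (γ δ : PRaw n) → IsSurj γ → IsSurj δ → γ ⊆P δ → Γ γ ⊆T Γ δ
Γ-mono-⊆ (zero , Vec.[])       (_ , Vec.[]) _ _ _ = ε
Γ-mono-⊆ {n} (suc r , γ) (s , δ) surjγ surjδ (ρ , mono , _ , refl) =
  subst₂ _⊆T_ (sym (Γ≡tree γ surjγ)) (sym (trans (Γ≡tree (Vec.map ρ γ) surjδ) (cong (tree n) (values-map ρ γ))))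
    (tree-map-⊆T n (values γ) (mono ∘ clamp-mono r) (≤-reflexive (length-values γ)))

Γ-mono-step : ∀ {n} {γ δ : PRaw n} → StepB n γ δ → Γ γ ≤BT Γ δ
Γ-mono-step {n} (up γ i surj before) =
  subst₂ _≤BT_ (sym (Γ≡tree γ surj)) (sym (Γ-t≡tree i γ surj))
    (tree-tℕ-up (toℕ i) n (values γ) (≤-reflexive (length-values γ)) i-before-suc-i)
  where
  i-before-suc-i : AllBefore (toℕ i) (suc (toℕ i)) (values γ)
  i-before-suc-i = subst (λ j → AllBefore j (suc (toℕ i)) (values γ)) (toℕ-inject₁ i)
                         (AllBefore-values γ (inject₁ i) (Fin.suc i) before)
Γ-mono-step {n} (down γ i surj after) =
  subst₂ _≤BT_ (sym (Γ-t≡tree i γ surj)) (sym (Γ≡tree γ surj))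
    (tree-tℕ-down (toℕ i) n (values γ) (≤-reflexive (length-values γ)) suc-i-before-i)
  where
  suc-i-before-i : AllBefore (suc (toℕ i)) (toℕ i) (values γ)
  suc-i-before-i = subst (λ j → AllBefore (suc (toℕ i)) j (values γ)) (toℕ-inject₁ i)
                         (AllBefore-values γ (Fin.suc i) (inject₁ i) (λ x y ex ey → after y x ey ex))

Γ-mono-≤B : ∀ {n} {γ δ : PRaw n} → γ ≤BP δ → Γ γ ≤BT Γ δ
Γ-mono-≤B ε            = ≤BT-refl
Γ-mono-≤B (step ◅ γ≤δ) = ≤BT-trans (Γ-mono-step step) (Γ-mono-≤B γ≤δ)

mainTheorem13 : ∀ (n : ℕ) (γ δ : PRaw n) → IsSurj γ → IsSurj δ →
                  (γ ⊆P δ → Γ γ ⊆T Γ δ) × (γ ≤BP δ → Γ γ ≤BT Γ δ)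
mainTheorem13 n γ δ surjγ surjδ = Γ-mono-⊆ γ δ surjγ surjδ , Γ-mono-≤B
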